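{- For every set $\mathcal R$ of relational atoms, multiset $\Gamma$ of labelled formulas, world symbols $v,w$ and closed formula $A$: if $v$ and $w$ are connected in $\mathcal R$, then $\ell\mathsf{IKt}2\vdash\mathcal R\mid\Gamma,v:\bot\Rightarrow w:A$.
   Context: Formulas: $A ::= P \mid X \mid A\to B \mid \Box A \mid \blacksquare A \mid \forall X A$ over propositional symbols $P$ and second-order variables $X$; $\bot:=\forall XX$; $A[C/X]$ capture-avoiding substitution. Labelled sequents: world symbols $u,v,w,\dots$; relational atoms $vRw$; labelled formulas $v:A$ with $A$ closed; sequents $\mathcal R\mid\Gamma\Rightarrow\Delta$ with $\mathcal R$ a set of relational atoms and $\Gamma,\Delta$ multisets of labelled formulas. $v$ and $w$ are connected in $\mathcal R$ if there is a sequence $v=v_0,\dots,v_n=w$ ($n\ge0$) with $v_iRv_{i+1}\in\mathcal R$ or $v_{i+1}Rv_i\in\mathcal R$ for each $i<n$. $\ell\mathsf{Kt}2$ rules (fresh = not occurring in the conclusion): id: $\mathcal R\mid v:A\Rightarrow v:A$; cut: from $\mathcal R\mid\Gamma\Rightarrow\Delta,v:A$ and $\mathcal R\mid\Gamma',v:A\Rightarrow\Delta'$ infer $\mathcal R\mid\Gamma,\Gamma'\Rightarrow\Delta,\Delta'$; weakening and contraction on both sides; $\to$L: from $\mathcal R\mid\Gamma\Rightarrow\Delta,v:A$ and $\mathcal R\mid\Gamma',v:B\Rightarrow\Delta'$ infer $\mathcal R\mid\Gamma,\Gamma',v:A\to B\Rightarrow\Delta,\Delta'$; $\to$R: from $\mathcal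 R\mid\Gamma,v:A\Rightarrow\Delta,v:B$ infer $\mathcal R\mid\Gamma\Rightarrow\Delta,v:A\to B$; $\forall$L: from $\mathcal R\mid\Gamma,v:A[C/X]\Rightarrow\Delta$ infer $\mathcal R\mid\Gamma,v:\forall XA\Rightarrow\Delta$ (any closed $C$); $\forall$R: from $\mathcal R\mid\Gamma\Rightarrow\Delta,v:A[P/X]$ infer $\mathcal R\mid\Gamma\Rightarrow\Delta,v:\forall XA$, $P$ fresh; $\Box$L: from $\mathcal R,vRw\mid\Gamma,w:A\Rightarrow\Delta$ infer $\mathcal R,vRw\mid\Gamma,v:\Box A\Rightarrow\Delta$; $\Box$R: from $\mathcal R,vRw\mid\Gamma\Rightarrow\Delta,w:A$ infer $\mathcal R\mid\Gamma\Rightarrow\Delta,v:\Box A$, $w$ fresh; $\blacksquare$L: from $\mathcal R,uRv\mid\Gamma,u:A\Rightarrow\Delta$ infer $\mathcal R,uRv\mid\Gamma,v:\blacksquare A\Rightarrow\Delta$; $\blacksquare$R: from $\mathcal R,uRv\mid\Gamma\Rightarrow\Delta,u:A$ infer $\mathcal R\mid\Gamma\Rightarrow\Delta,v:\blacksquare A$, $u$ fresh. $\ell\mathsf{IKt}2$ is the restriction of $\ell\mathsf{Kt}2$ to sequents with singleton right-hand side. -}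

module Defs where

open import Data.Nat using (ℕ; zero; suc)
open import Data.Fin using (Fin; zero; suc)
open import Data.Product using (_×_; _,_)
open import Data.Sum using (_⊎_)
open import Data.List using (List; []; _∷_; _++_; [_])
open import Data.List.Membership.Propositional using (_∈_)
open import Data.List.Relation.Unary.Any using (Any)
open import Data.List.Relation.Binary.Permutation.Propositional using (_↭_)
open import Relation.Binary.PropositionalEquality using (_≡_)
open import Relation.Nullary using (¬_)

-- Second-order formulas, scoped de Bruijn syntax.
-- Fm n : formulas with at most n free second-order variables.
-- Propositional symbols P are natural numbers.

data Fm (n : ℕ) : Set where
  atom : ℕ → Fm n
  var  : Fin n → Fm n
  _⇒_  : Fm n → Fm n → Fm n
  □    : Fm n → Fm n
  ■    : Fm n → Fm n
  all  : Fm (suc n) → Fm n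

infixr 6 _⇒_

Closed : Set
Closed = Fm 0

ext : ∀ {n m} → (Fin n → Fin m) → Fin (suc n) → Fin (suc m)
ext ρ zero    = zero
ext ρ (suc i) = suc (ρ i)

rename : ∀ {n m} → (Fin n → Fin m) → Fm n → Fm m
rename ρ (atom p) = atom p
rename ρ (var i)  = var (ρ i)
rename ρ (A ⇒ B)  = rename ρ A ⇒ rename ρ B
rename ρ (□ A)    = □ (rename ρ A)
rename ρ (■ A)    = ■ (rename ρ A)
rename ρ (all A)  = all (rename (ext ρ) A)

exts : ∀ {n m} → (Fin n → Fm m) → Fin (suc n) → Fm (suc m)
exts σ zero    = var zero
exts σ (suc i) = rename suc (σ i)

subst : ∀ {n m} → (Fin n → Fm m) → Fm n → Fm m
subst σ (atom p) = atom p
subst σ (var i)  = σ i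
subst σ (A ⇒ B)  = subst σ A ⇒ subst σ B
subst σ (□ A)    = □ (subst σ A)
subst σ (■ A)    = ■ (subst σ A)
subst σ (all A)  = all (subst (exts σ) A)

single : Closed → Fin 1 → Closed
single C zero = C

_[_/X] : Fm 1 → Closed → Closed
A [ C /X] = subst (single C) A

⊥' : Closed
⊥' = all (var zero)

data OccP (p : ℕ) : ∀ {n} → Fm n → Set where
  here : ∀ {n} → OccP p {n} (atom p)
  ⇒l   : ∀ {n} {A B : Fm n} → OccP p A → OccP p (A ⇒ B)
  ⇒r   : ∀ {n} {A B : Fm n} → OccP p B → OccP p (A ⇒ B)
  □o   : ∀ {n} {A : Fm n} → OccP p A → OccP p (□ A)
  ■o   : ∀ {n} {A : Fm n} → OccP p A → OccP p (■ A)
  allo : ∀ {n} {A : Fm (suc n)} → OccP p A → OccP p (all A)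

World : Set
World = ℕ

-- relational atom vRw is the pair (v , w)
RelAtom : Set
RelAtom = World × World

LFm : Set
LFm = World × Closed

-- set of relational atoms, represented by a list (only membership and
-- extension are used by the rules)
Rel : Set
Rel = List RelAtom

-- multiset of labelled formulas, represented by a list up to permutation
Ctx : Set
Ctx = List LFm

OccPCtx : ℕ → Ctx → Set
OccPCtx p Γ = Any (λ (x : LFm) → OccP p (Data.Product.proj₂ x)) Γ
  where import Data.Product

OccWRel : World → Rel → Set
OccWRel u R = Any (λ (a : RelAtom) → (Data.Product.proj₁ a ≡ u) ⊎ (Data.Product.proj₂ a ≡ u)) R
  where import Data.Product

OccWCtx : World → Ctx → Set
OccWCtx u Γ = Any (λ (x : LFm) → Data.Product.proj₁ x ≡ u) Γ
  where import Data.Product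

-- ℓIKt2: ℓKt2 restricted to sequents R | Γ ⇒ w:A with exactly one
-- labelled formula on the right.  Right weakening/contraction cannot
-- occur in this fragment; multiset structure of Γ is expressed by the
-- exchange rule `perm`.

data ⊢IKt2 : Rel → Ctx → LFm → Set where
  id   : ∀ {R v A} → ⊢IKt2 R [ (v , A) ] (v , A)
  cut  : ∀ {R Γ Γ' v A D} →
         ⊢IKt2 R Γ (v , A) → ⊢IKt2 R (Γ' ++ [ (v , A) ]) D →
         ⊢IKt2 R (Γ ++ Γ') D
  perm : ∀ {R Γ Γ' D} → Γ ↭ Γ' → ⊢IKt2 R Γ D → ⊢IKt2 R Γ' D
  wkL  : ∀ {R Γ x D} → ⊢IKt2 R Γ D → ⊢IKt2 R (Γ ++ [ x ]) D
  ctrL : ∀ {R Γ x D} → ⊢IKt2 R (Γ ++ x ∷ [ x ]) D → ⊢IKt2 R (Γ ++ [ x ]) D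
  ⇒L   : ∀ {R Γ Γ' v A B D} →
         ⊢IKt2 R Γ (v , A) → ⊢IKt2 R (Γ' ++ [ (v , B) ]) D →
         ⊢IKt2 R (Γ ++ Γ' ++ [ (v , A ⇒ B) ]) D
  ⇒R   : ∀ {R Γ v A B} →
         ⊢IKt2 R (Γ ++ [ (v , A) ]) (v , B) → ⊢IKt2 R Γ (v , A ⇒ B)
  ∀L   : ∀ {R Γ v A D} (C : Closed) →
         ⊢IKt2 R (Γ ++ [ (v , A [ C /X]) ]) D →
         ⊢IKt2 R (Γ ++ [ (v , all A) ]) D
  ∀R   : ∀ {R Γ v A} (p : ℕ) →
         ¬ OccPCtx p Γ → ¬ OccP p (all A) →
         ⊢IKt2 R Γ (v , A [ atom p /X]) → ⊢IKt2 R Γ (v , all A)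
  □L   : ∀ {R Γ v w A D} → (v , w) ∈ R →
         ⊢IKt2 R (Γ ++ [ (w , A) ]) D →
         ⊢IKt2 R (Γ ++ [ (v , □ A) ]) D
  □R   : ∀ {R Γ v A} (w : World) →
         ¬ OccWRel w R → ¬ OccWCtx w Γ → ¬ (w ≡ v) →
         ⊢IKt2 ((v , w) ∷ R) Γ (w , A) → ⊢IKt2 R Γ (v , □ A)
  ■L   : ∀ {R Γ u v A D} → (u , v) ∈ R →
         ⊢IKt2 R (Γ ++ [ (u , A) ]) D →
         ⊢IKt2 R (Γ ++ [ (v , ■ A) ]) D
  ■R   : ∀ {R Γ v A} (u : World) →
         ¬ OccWRel u R → ¬ OccWCtx u Γ → ¬ (u ≡ v) →
         ⊢IKt2 ((u , v) ∷ R) Γ (u , A) → ⊢IKt2 R Γ (v , ■ A)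

data Connected (R : Rel) (v : World) : World → Set where
  refl : Connected R v v
  step : ∀ {u w} → Connected R v u → ((u , w) ∈ R ⊎ (w , u) ∈ R) →
         Connected R v w

-- v:⊥ yields v:A for every A by ∀L with C := A. Along an edge uRw, a derivation
-- of u:□A gives w:A by cutting against w:A ⇒ w:A under □L, and symmetrically
-- an edge wRu turns u:■A into w:A under ■L. Induction on the connecting path,
-- with the formula strengthened to □A or ■A at each step back, reaches v.

module Submission where

open import Defs
open import Data.List using ([]; _∷_; _++_; [_])
open import Data.List.Properties using (++-assoc; ++-identityʳ)
open import Data.List.Membership.Propositional using (_∈_)
open import Data.List.Relation.Binary.Permutation.Propositional using (↭-reflexive)
open import Data.List.Relation.Binary.Permutation.Propositional.Properties using (++-comm)
open import Data.Product using (_,_)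
open import Data.Sum using (inj₁; inj₂)
open import Relation.Binary.PropositionalEquality using (sym)

weakenʳ : ∀ {R Δ D} (Γ : Ctx) → ⊢IKt2 R Δ D → ⊢IKt2 R (Δ ++ Γ) D
weakenʳ {Δ = Δ} []      d = perm (↭-reflexive (sym (++-identityʳ Δ))) d
weakenʳ {Δ = Δ} (x ∷ Γ) d = perm (↭-reflexive (++-assoc Δ [ x ] Γ)) (weakenʳ Γ (wkL d))

weakenˡ : ∀ {R Δ D} (Γ : Ctx) → ⊢IKt2 R Δ D → ⊢IKt2 R (Γ ++ Δ) D
weakenˡ {Δ = Δ} Γ d = perm (++-comm Δ Γ) (weakenʳ Γ d)

cut-single : ∀ {R Γ x D} → ⊢IKt2 R Γ x → ⊢IKt2 R [ x ] D → ⊢IKt2 R Γ D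
cut-single {Γ = Γ} d e = perm (↭-reflexive (++-identityʳ Γ)) (cut {Γ' = []} d e)

□-along : ∀ {R Γ u w A} → (u , w) ∈ R → ⊢IKt2 R Γ (u , □ A) → ⊢IKt2 R Γ (w , A)
□-along uRw d = cut-single d (□L {Γ = []} uRw id)

■-along : ∀ {R Γ u w A} → (w , u) ∈ R → ⊢IKt2 R Γ (u , ■ A) → ⊢IKt2 R Γ (w , A)
■-along wRu d = cut-single d (■L {Γ = []} wRu id)

⊥-elim-here : ∀ {R} (Γ : Ctx) (v : World) (A : Closed) → ⊢IKt2 R (Γ ++ [ (v , ⊥') ]) (v , A)
⊥-elim-here Γ v A = ∀L A (weakenˡ Γ id)

lemma4p2 : (R : Rel) (Γ : Ctx) (v w : World) (A : Closed) →
    Connected R v w → ⊢IKt2 R (Γ ++ [ (v , ⊥') ]) (w , A)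
lemma4p2 R Γ v .v A refl                    = ⊥-elim-here Γ v A
lemma4p2 R Γ v w  A (step {u} c (inj₁ uRw)) = □-along uRw (lemma4p2 R Γ v u (□ A) c)
lemma4p2 R Γ v w  A (step {u} c (inj₂ wRu)) = ■-along wRu (lemma4p2 R Γ v u (■ A) c)
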